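{- Let $F_q$ be the finite field with $q$ elements, $V=F_q^n$, and $1<k<n-1$. Let $U$ be a projective code $[n,k+1]_q$ with generator matrix $M$ whose rows $v_1,\dots,v_{k+1}$ form a basis of $U$ and whose columns are $l_1,\dots,l_n\in F_q^{k+1}$. Let $W$ be the set of all non-zero vectors $w=(w_1,\dots,w_{k+1})\in F_q^{k+1}$ that are not proportional to any column of $M$, and for $w\in W$ let $$C(w)=\Big\{\sum_{i=1}^{k+1}a_iv_i \;:\; a_1,\dots,a_{k+1}\in F_q,\ \sum_{i=1}^{k+1}a_iw_i=0\Big\}.$$ Let $Y\subseteq W$ be the set of all $w\in W$ such that $w\neq \alpha l_i+\beta l_j$ for all $\alpha,\beta\in F_q\setminus\{0\}$ and all columns $l_i,l_j$ of $M$. Then the set $\langle U]^{\Pi}_k$ of all projective codes $[n,k]_q$ contained in $U$ is exactly $\{C(y): y\in Y\}$.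
   Context: A linear code $[n,k]_q$ is a $k$-dimensional subspace of $V=F_q^n$; a generator matrix is a matrix whose rows form a basis of the code. A linear code is projective if its generator matrices contain no zero columns and no two proportional columns. -}

module Defs where

open import Level using (0ℓ)
open import Algebra.Bundles using (CommutativeRing)
open import Data.Nat using (ℕ; zero; suc)
open import Data.Fin using (Fin; zero; suc)
open import Data.Product using (Σ; ∃; ∃-syntax; _×_; _,_)
open import Relation.Nullary using (¬_)
open import Relation.Binary.PropositionalEquality using (_≡_)
open import Relation.Unary using (Pred; _∈_)

record Field : Set₁ where
  field
    commutativeRing : CommutativeRing 0ℓ 0ℓ
  open CommutativeRing commutativeRing public
  field
    1≉0     : ¬ (1# ≈ 0#)
    inverse : ∀ x → ¬ (x ≈ 0#) → ∃[ y ] (x * y ≈ 1#)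

record FiniteField (q : ℕ) : Set₁ where
  field
    field′     : Field
  open Field field′ public
  field
    enum       : Fin q → Carrier
    enum-inj   : ∀ i j → enum i ≈ enum j → i ≡ j
    enum-surj  : ∀ x → ∃[ i ] (enum i ≈ x)

module Codes (F : Field) where
  open Field F using (Carrier; _≈_; _+_; _*_; 0#; 1#)

  Vec : ℕ → Set
  Vec m = Fin m → Carrier

  ∑ : ∀ {m} → (Fin m → Carrier) → Carrier
  ∑ {zero}  f = 0#
  ∑ {suc m} f = f zero + ∑ (λ i → f (suc i))

  _≈ᵥ_ : ∀ {m} → Vec m → Vec m → Set
  u ≈ᵥ v = ∀ i → u i ≈ v i

  0ᵥ : ∀ {m} → Vec m
  0ᵥ _ = 0#

  _·ᵥ_ : ∀ {m} → Carrier → Vec m → Vec m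
  (a ·ᵥ v) i = a * v i

  _+ᵥ_ : ∀ {m} → Vec m → Vec m → Vec m
  (u +ᵥ v) i = u i + v i

  Proportional : ∀ {m} → Vec m → Vec m → Set
  Proportional u v = ∃[ c ] (u ≈ᵥ (c ·ᵥ v))

  Matrix : ℕ → ℕ → Set
  Matrix r n = Fin r → Vec n

  lincomb : ∀ {r n} → Matrix r n → Vec r → Vec n
  lincomb M a j = ∑ (λ i → a i * M i j)

  column : ∀ {r n} → Matrix r n → Fin n → Vec r
  column M j i = M i j

  RowsIndependent : ∀ {r n} → Matrix r n → Set
  RowsIndependent M = ∀ a → lincomb M a ≈ᵥ 0ᵥ → ∀ i → a i ≈ 0#

  RowSpace : ∀ {r n} → Matrix r n → Pred (Vec n) 0ℓ
  RowSpace M x = ∃[ a ] (x ≈ᵥ lincomb M a)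

  IsGeneratorMatrix : ∀ {r n} → Pred (Vec n) 0ℓ → Matrix r n → Set
  IsGeneratorMatrix C G = RowsIndependent G × (∀ x → (x ∈ C → x ∈ RowSpace G) × (x ∈ RowSpace G → x ∈ C))

  ProjectiveColumns : ∀ {r n} → Matrix r n → Set
  ProjectiveColumns G =
    (∀ j → ¬ (column G j ≈ᵥ 0ᵥ)) ×
    (∀ i j → ¬ (i ≡ j) → ¬ Proportional (column G i) (column G j))

  -- C is a projective [n,k]_q code: a k-dimensional subspace of F^n (i.e. it has
  -- a k × n generator matrix) with a projective generator matrix
  IsProjectiveCode : ∀ n k → Pred (Vec n) 0ℓ → Set
  IsProjectiveCode n k C = ∃[ G ] (IsGeneratorMatrix {k} {n} C G × ProjectiveColumns G)

  InW : ∀ {r n} → Matrix r n → Vec r → Set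
  InW M w = ¬ (w ≈ᵥ 0ᵥ) × (∀ j → ¬ Proportional w (column M j))

  InY : ∀ {r n} → Matrix r n → Vec r → Set
  InY M w = InW M w ×
    (∀ α β i j → ¬ (α ≈ 0#) → ¬ (β ≈ 0#) →
       ¬ (w ≈ᵥ ((α ·ᵥ column M i) +ᵥ (β ·ᵥ column M j))))

  Cw : ∀ {r n} → Matrix r n → Vec r → Pred (Vec n) 0ℓ
  Cw M w x = ∃[ a ] ((∑ (λ i → a i * w i) ≈ 0#) × (x ≈ᵥ lincomb M a))

  SameSet : ∀ {n} → Pred (Vec n) 0ℓ → Pred (Vec n) 0ℓ → Set
  SameSet C D = ∀ x → (x ∈ C → x ∈ D) × (x ∈ D → x ∈ C)

{-# OPTIONS --safe #-}
-- A projective [n,k] subcode C of U = RowSpace M has a generator matrix G = A M, where A is a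
-- k × (k+1) matrix with independent rows.  By Gaussian elimination such an A has a nonzero normal
-- vector y whose orthogonal complement is exactly the row space of A, and then C = C(y).
-- Conversely every y ≠ 0 has a basis B of its orthogonal complement whose kernel is the line
-- through y, and C(y) is generated by B M.  In both cases the columns of the generator matrix are
-- the images A lⱼ of the columns of M under a linear map with kernel ⟨y⟩, and these are nonzero and
-- pairwise non-proportional exactly when y ∈ Y: A lⱼ = 0 means lⱼ ∈ ⟨y⟩, and A lᵢ = c A lⱼ means
-- lᵢ - c lⱼ ∈ ⟨y⟩.
module Submission where

open import Defs
open import Data.Nat using (ℕ; suc; _<_; _∸_)
open import Data.Product using (_×_; ∃-syntax)
open import Relation.Unary using (_⊆_)

open import Level using (0ℓ)
open import Data.Nat using (zero)
open import Data.Fin as Fin using (Fin; zero; suc; punchIn; punchOut)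
open import Data.Fin.Properties using (punchIn-punchOut; ¬∀⟶∃¬)
open import Data.Product using (_,_; proj₁; proj₂; swap)
open import Data.Vec.Functional using (_∷_; insertAt; removeAt)
open import Data.Vec.Functional.Properties using (insertAt-lookup; insertAt-punchIn; removeAt-insertAt)
open import Function using (_∘_)
open import Relation.Binary using (Decidable)
open import Relation.Binary.PropositionalEquality as ≡ using (_≡_; _≢_)
open import Relation.Nullary using (¬_; yes; no)
open import Relation.Unary using (Pred; _∈_)

module _ {q} (Fq : FiniteField q) where
  open FiniteField Fq

  ≈-dec : Decidable _≈_
  ≈-dec x y with enum-surj x | enum-surj y
  ... | i , eᵢ≈x | j , eⱼ≈y with i Fin.≟ j
  ...   | yes ≡.refl = yes (trans (sym eᵢ≈x) eⱼ≈y)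
  ...   | no i≢j     = no λ x≈y → i≢j (enum-inj i j (trans eᵢ≈x (trans x≈y (sym eⱼ≈y))))

module _ (F : Field) where
  open Field F hiding (zero)
  open Codes F
  open import Algebra.Properties.Ring ring
    using ( -‿distribˡ-*; -‿distribʳ-*; -‿involutive; -0#≈0#
          ; +-inverseˡ-unique; +-inverseʳ-unique; +-cancelʳ; //-rightDividesˡ)
  open import Algebra.Properties.CommutativeSemigroup *-commutativeSemigroup
    using (x∙yz≈z∙xy; xy∙z≈x∙zy; xy∙z≈xz∙y)
  import Algebra.Properties.Semiring.Sum semiring as Sum
  open import Relation.Binary.Reasoning.Setoid setoid

  private variable k m n r : ℕ

  inv : (x : Carrier) → x ≉ 0# → Carrier
  inv x x≉0 = proj₁ (inverse x x≉0)

  *-inverseʳ : ∀ x (x≉0 : x ≉ 0#) → x * inv x x≉0 ≈ 1#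
  *-inverseʳ x x≉0 = proj₂ (inverse x x≉0)

  inv-cancelˡ : ∀ x (x≉0 : x ≉ 0#) a → inv x x≉0 * (x * a) ≈ a
  inv-cancelˡ x x≉0 a = begin
    inv x x≉0 * (x * a)  ≈⟨ *-assoc _ x a ⟨
    inv x x≉0 * x * a    ≈⟨ *-congʳ (trans (*-comm _ x) (*-inverseʳ x x≉0)) ⟩
    1# * a               ≈⟨ *-identityˡ a ⟩
    a                    ∎

  inv-cancelʳ : ∀ x (x≉0 : x ≉ 0#) a → inv x x≉0 * a * x ≈ a
  inv-cancelʳ x x≉0 a = trans (xy∙z≈x∙zy _ a x) (inv-cancelˡ x x≉0 a)

  *-solveˡ : ∀ {x y z} (x≉0 : x ≉ 0#) → z ≈ x * y → y ≈ inv x x≉0 * z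
  *-solveˡ {x} {y} x≉0 z≈xy = trans (sym (inv-cancelˡ x x≉0 y)) (*-congˡ (sym z≈xy))

  *-cancelʳ-≉0 : ∀ {x y z} → z ≉ 0# → x * z ≈ y * z → x ≈ y
  *-cancelʳ-≉0 {x} {y} {z} z≉0 xz≈yz = begin
    x                    ≈⟨ *-solveˡ z≉0 (*-comm x z) ⟩
    inv z z≉0 * (x * z)  ≈⟨ *-congˡ xz≈yz ⟩
    inv z z≉0 * (y * z)  ≈⟨ *-solveˡ z≉0 (*-comm y z) ⟨
    y                    ∎

  xy≈0⇒y≈0 : ∀ {x y} → x ≉ 0# → x * y ≈ 0# → y ≈ 0#
  xy≈0⇒y≈0 x≉0 xy≈0 = trans (*-solveˡ x≉0 (sym xy≈0)) (zeroʳ _)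

  inv≉0 : ∀ x (x≉0 : x ≉ 0#) → inv x x≉0 ≉ 0#
  inv≉0 x x≉0 inv≈0 = 1≉0 (trans (sym (*-inverseʳ x x≉0)) (trans (*-congˡ inv≈0) (zeroʳ x)))

  *-≉0 : ∀ {x y} → x ≉ 0# → y ≉ 0# → x * y ≉ 0#
  *-≉0 x≉0 y≉0 xy≈0 = y≉0 (xy≈0⇒y≈0 x≉0 xy≈0)

  -‿≉0 : ∀ {x} → x ≉ 0# → - x ≉ 0#
  -‿≉0 {x} x≉0 -x≈0 = x≉0 (trans (sym (-‿involutive x)) (trans (-‿cong -x≈0) -0#≈0#))

  -[-x*y]≈x*y : ∀ x y → - (- x * y) ≈ x * y
  -[-x*y]≈x*y x y = trans (-‿cong (sym (-‿distribˡ-* x y))) (-‿involutive _)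

  solve-linear : ∀ {α β u v} (α≉0 : α ≉ 0#) → α * u + β * v ≈ 0# → u ≈ - (inv α α≉0 * β) * v
  solve-linear {α} {β} {u} {v} α≉0 αu+βv≈0 = begin
    u                  ≈⟨ *-solveˡ α≉0 (sym (+-inverseˡ-unique _ _ αu+βv≈0)) ⟩
    α⁻¹ * - (β * v)    ≈⟨ -‿distribʳ-* α⁻¹ _ ⟨
    - (α⁻¹ * (β * v))  ≈⟨ -‿cong (*-assoc α⁻¹ β v) ⟨
    - (α⁻¹ * β * v)    ≈⟨ -‿distribˡ-* _ v ⟩
    - (α⁻¹ * β) * v    ∎
    where α⁻¹ = inv α α≉0

  -- Finite sums and the dot product

  -- ∑ unfolds exactly like the library's sum, so its laws are transported from there.
  ∑≡sum : (f : Fin m → Carrier) → ∑ f ≡ Sum.sum f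
  ∑≡sum {zero}  f = ≡.refl
  ∑≡sum {suc m} f = ≡.cong (f zero +_) (∑≡sum (f ∘ suc))

  ∑-cong : {f g : Fin m → Carrier} → (∀ i → f i ≈ g i) → ∑ f ≈ ∑ g
  ∑-cong {f = f} {g} f≈g = begin
    ∑ f        ≡⟨ ∑≡sum f ⟩
    Sum.sum f  ≈⟨ Sum.sum-cong-≋ f≈g ⟩
    Sum.sum g  ≡⟨ ∑≡sum g ⟨
    ∑ g        ∎

  ∑-zero : {f : Fin m → Carrier} → (∀ i → f i ≈ 0#) → ∑ f ≈ 0#
  ∑-zero {m} {f} f≈0 = begin
    ∑ f                     ≈⟨ ∑-cong f≈0 ⟩
    ∑ {m} (λ _ → 0#)        ≡⟨ ∑≡sum {m} (λ _ → 0#) ⟩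
    Sum.sum {m} (λ _ → 0#)  ≈⟨ Sum.sum-replicate-zero m ⟩
    0#                      ∎

  ∑-distrib-+ : (f g : Fin m → Carrier) → ∑ (λ i → f i + g i) ≈ ∑ f + ∑ g
  ∑-distrib-+ f g = begin
    ∑ (λ i → f i + g i)        ≡⟨ ∑≡sum (λ i → f i + g i) ⟩
    Sum.sum (λ i → f i + g i)  ≈⟨ Sum.∑-distrib-+ f g ⟩
    Sum.sum f + Sum.sum g      ≡⟨ ≡.cong₂ _+_ (∑≡sum f) (∑≡sum g) ⟨
    ∑ f + ∑ g                  ∎

  ∑-comm : (f : Fin m → Fin n → Carrier) → ∑ (λ i → ∑ (f i)) ≈ ∑ (λ j → ∑ (λ i → f i j))
  ∑-comm f = begin
    ∑ (λ i → ∑ (f i))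
      ≡⟨ ≡.trans (∑≡sum (λ i → ∑ (f i))) (Sum.sum-cong-≗ (∑≡sum ∘ f)) ⟩
    Sum.sum (λ i → Sum.sum (f i))
      ≈⟨ Sum.∑-comm f ⟩
    Sum.sum (λ j → Sum.sum (λ i → f i j))
      ≡⟨ ≡.trans (∑≡sum (λ j → ∑ (λ i → f i j))) (Sum.sum-cong-≗ (λ j → ∑≡sum (λ i → f i j))) ⟨
    ∑ (λ j → ∑ (λ i → f i j))
      ∎

  *-distribˡ-∑ : ∀ x (f : Fin m → Carrier) → x * ∑ f ≈ ∑ (λ i → x * f i)
  *-distribˡ-∑ x f = begin
    x * ∑ f                  ≡⟨ ≡.cong (x *_) (∑≡sum f) ⟩
    x * Sum.sum f            ≈⟨ Sum.*-distribˡ-sum x f ⟩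
    Sum.sum (λ i → x * f i)  ≡⟨ ∑≡sum (λ i → x * f i) ⟨
    ∑ (λ i → x * f i)        ∎

  ∑-remove : (p : Fin (suc m)) (f : Fin (suc m) → Carrier) → ∑ f ≈ f p + ∑ (removeAt f p)
  ∑-remove p f = begin
    ∑ f                           ≡⟨ ∑≡sum f ⟩
    Sum.sum f                     ≈⟨ Sum.sum-remove f ⟩
    f p + Sum.sum (removeAt f p)  ≡⟨ ≡.cong (f p +_) (∑≡sum (removeAt f p)) ⟨
    f p + ∑ (removeAt f p)        ∎

  infix 7 _·_
  _·_ : Vec m → Vec m → Carrier
  u · v = ∑ (λ i → u i * v i)

  infix 4 _⟂_
  _⟂_ : Vec m → Vec m → Set
  u ⟂ v = u · v ≈ 0#

  ·-cong : {u u′ v v′ : Vec m} → u ≈ᵥ u′ → v ≈ᵥ v′ → u · v ≈ u′ · v′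
  ·-cong u≈u′ v≈v′ = ∑-cong (λ i → *-cong (u≈u′ i) (v≈v′ i))

  ·-comm : (u v : Vec m) → u · v ≈ v · u
  ·-comm u v = ∑-cong (λ i → *-comm (u i) (v i))

  ·-zeroˡ : {u : Vec m} (v : Vec m) → u ≈ᵥ 0ᵥ → u · v ≈ 0#
  ·-zeroˡ v u≈0 = ∑-zero (λ i → trans (*-congʳ (u≈0 i)) (zeroˡ (v i)))

  ·-zeroʳ : (u : Vec m) {v : Vec m} → v ≈ᵥ 0ᵥ → u · v ≈ 0#
  ·-zeroʳ u v≈0 = ∑-zero (λ i → trans (*-congˡ (v≈0 i)) (zeroʳ (u i)))

  ·-distribʳ-+ᵥ : (u v w : Vec m) → (u +ᵥ v) · w ≈ u · w + v · w
  ·-distribʳ-+ᵥ u v w = trans (∑-cong (λ i → distribʳ (w i) (u i) (v i)))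
                              (∑-distrib-+ (λ i → u i * w i) (λ i → v i * w i))

  ·-distribˡ-+ᵥ : (u v w : Vec m) → u · (v +ᵥ w) ≈ u · v + u · w
  ·-distribˡ-+ᵥ u v w = trans (∑-cong (λ i → distribˡ (u i) (v i) (w i)))
                              (∑-distrib-+ (λ i → u i * v i) (λ i → u i * w i))

  ·ᵥ-· : ∀ x (u v : Vec m) → (x ·ᵥ u) · v ≈ x * (u · v)
  ·ᵥ-· x u v = trans (∑-cong (λ i → *-assoc x (u i) (v i))) (sym (*-distribˡ-∑ x (λ i → u i * v i)))

  ·-·ᵥ : ∀ x (u v : Vec m) → u · (x ·ᵥ v) ≈ x * (u · v)
  ·-·ᵥ x u v = trans (·-comm u _) (trans (·ᵥ-· x v u) (*-congˡ (·-comm v u)))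

  ·-*ʳ : (u v : Vec m) (x : Carrier) → u · (λ i → v i * x) ≈ (u · v) * x
  ·-*ʳ u v x = trans (∑-cong (λ i → x∙yz≈z∙xy (u i) (v i) x))
                     (trans (sym (*-distribˡ-∑ x (λ i → u i * v i))) (*-comm x _))

  ·-remove : (p : Fin (suc m)) (u v : Vec (suc m)) →
             u · v ≈ u p * v p + removeAt u p · removeAt v p
  ·-remove p u v = ∑-remove p (λ i → u i * v i)

  ·-insertAt : (u : Vec (suc m)) (w : Vec m) (p : Fin (suc m)) (x : Carrier) →
               u · insertAt w p x ≈ u p * x + removeAt u p · w
  ·-insertAt u w p x = trans (·-remove p u (insertAt w p x))
    (+-cong (*-congˡ (reflexive (insertAt-lookup w p x)))
            (·-cong (λ _ → refl) (reflexive ∘ removeAt-insertAt w p x)))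

  ·-insertAt-vanishing : (u : Vec (suc m)) (w : Vec m) (p : Fin (suc m)) (x : Carrier) →
                         u p ≈ 0# → u · insertAt w p x ≈ removeAt u p · w
  ·-insertAt-vanishing u w p x uₚ≈0 = trans (·-insertAt u w p x)
    (trans (+-congʳ (trans (*-congʳ uₚ≈0) (zeroˡ x))) (+-identityˡ _))

  insertAt-· : (w : Vec m) (p : Fin (suc m)) (x : Carrier) (v : Vec (suc m)) →
               insertAt w p x · v ≈ x * v p + w · removeAt v p
  insertAt-· w p x v = trans (·-remove p (insertAt w p x) v)
    (+-cong (*-congʳ (reflexive (insertAt-lookup w p x)))
            (·-cong (reflexive ∘ removeAt-insertAt w p x) (λ _ → refl)))

  insertAt-≉0 : {w : Vec m} (p : Fin (suc m)) (x : Carrier) → ¬ (w ≈ᵥ 0ᵥ) → ¬ (insertAt w p x ≈ᵥ 0ᵥ)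
  insertAt-≉0 {w = w} p x w≉0 w′≈0 =
    w≉0 (λ s → trans (reflexive (≡.sym (insertAt-punchIn w p x s))) (w′≈0 (punchIn p s)))

  ≈ᵥ-split : {u v : Vec (suc m)} (p : Fin (suc m)) →
             u p ≈ v p → removeAt u p ≈ᵥ removeAt v p → u ≈ᵥ v
  ≈ᵥ-split {u = u} {v} p uₚ≈vₚ u⁻≈v⁻ j with j Fin.≟ p
  ... | yes ≡.refl = uₚ≈vₚ
  ... | no j≢p     = ≡.subst (λ i → u i ≈ v i) (punchIn-punchOut p≢j) (u⁻≈v⁻ (punchOut p≢j))
    where p≢j = j≢p ∘ ≡.sym

  ⟂-unique : {u w y : Vec (suc m)} (p : Fin (suc m)) → y p ≉ 0# →
             u ⟂ y → w ⟂ y → removeAt u p ≈ᵥ removeAt w p → u ≈ᵥ w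
  ⟂-unique {u = u} {w} {y} p yₚ≉0 u⟂y w⟂y u⁻≈w⁻ = ≈ᵥ-split p (*-cancelʳ-≉0 yₚ≉0 uₚyₚ≈wₚyₚ) u⁻≈w⁻
    where
    uₚyₚ≈wₚyₚ : u p * y p ≈ w p * y p
    uₚyₚ≈wₚyₚ = +-cancelʳ (removeAt w p · removeAt y p) _ _ (begin
      u p * y p + removeAt w p · removeAt y p  ≈⟨ +-congˡ (·-cong u⁻≈w⁻ (λ _ → refl)) ⟨
      u p * y p + removeAt u p · removeAt y p  ≈⟨ ·-remove p u y ⟨
      u · y                                    ≈⟨ trans u⟂y (sym w⟂y) ⟩
      w · y                                    ≈⟨ ·-remove p w y ⟩
      w p * y p + removeAt w p · removeAt y p  ∎)

  basis : Fin m → Vec m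
  basis zero    zero    = 1#
  basis zero    (suc _) = 0#
  basis (suc _) zero    = 0#
  basis (suc t) (suc s) = basis t s

  basis-diag : (t : Fin m) → basis t t ≡ 1#
  basis-diag zero    = ≡.refl
  basis-diag (suc t) = basis-diag t

  basis-comm : (t s : Fin m) → basis t s ≡ basis s t
  basis-comm zero    zero    = ≡.refl
  basis-comm zero    (suc s) = ≡.refl
  basis-comm (suc t) zero    = ≡.refl
  basis-comm (suc t) (suc s) = basis-comm t s

  basis-· : (t : Fin m) (v : Vec m) → basis t · v ≈ v t
  basis-· zero v = begin
    1# * v zero + 0ᵥ · (v ∘ suc)  ≈⟨ +-cong (*-identityˡ _) (·-zeroˡ (v ∘ suc) (λ _ → refl)) ⟩
    v zero + 0#                   ≈⟨ +-identityʳ _ ⟩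
    v zero                        ∎
  basis-· (suc t) v = begin
    0# * v zero + basis t · (v ∘ suc)  ≈⟨ +-cong (zeroˡ _) (basis-· t (v ∘ suc)) ⟩
    0# + v (suc t)                     ≈⟨ +-identityˡ _ ⟩
    v (suc t)                          ∎

  ·-basis : (v : Vec m) (t : Fin m) → v · basis t ≈ v t
  ·-basis v t = trans (·-comm v _) (basis-· t v)

  -- Matrices and row spaces

  infixr 25 _*ᵥ_ _*ₘ_
  _*ᵥ_ : Matrix k m → Vec m → Vec k
  (A *ᵥ v) t = A t · v

  _*ₘ_ : Matrix k r → Matrix r n → Matrix k n
  (A *ₘ M) t = lincomb M (A t)

  _≈ₘ_ : Matrix k n → Matrix k n → Set
  G ≈ₘ H = ∀ t → G t ≈ᵥ H t

  RowSpace≐⟂ : Matrix k m → Vec m → Set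
  RowSpace≐⟂ A y = A *ᵥ y ≈ᵥ 0ᵥ × (∀ a → a ⟂ y → a ∈ RowSpace A)

  lincomb-congʳ : (M : Matrix r n) {a b : Vec r} → a ≈ᵥ b → lincomb M a ≈ᵥ lincomb M b
  lincomb-congʳ M a≈b j = ·-cong a≈b (λ _ → refl)

  lincomb-basis : (M : Matrix m n) (t : Fin m) → lincomb M (basis t) ≈ᵥ M t
  lincomb-basis M t j = basis-· t (column M j)

  lincomb-· : (A : Matrix k m) (c : Vec k) (v : Vec m) → lincomb A c · v ≈ c · (A *ᵥ v)
  lincomb-· A c v = begin
    ∑ (λ i → ∑ (λ t → c t * A t i) * v i)    ≈⟨ ∑-cong (λ i → ·-*ʳ c (column A i) (v i)) ⟨
    ∑ (λ i → ∑ (λ t → c t * (A t i * v i)))  ≈⟨ ∑-comm (λ i t → c t * (A t i * v i)) ⟩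
    ∑ (λ t → ∑ (λ i → c t * (A t i * v i)))  ≈⟨ ∑-cong (λ t → *-distribˡ-∑ (c t) (λ i → A t i * v i)) ⟨
    c · (A *ᵥ v)                             ∎

  lincomb-factor : (A : Matrix k r) (M : Matrix r n) {G : Matrix k n} → G ≈ₘ A *ₘ M →
                   ∀ c → lincomb G c ≈ᵥ lincomb M (lincomb A c)
  lincomb-factor A M G≈AM c j =
    trans (·-cong (λ _ → refl) (λ t → G≈AM t j)) (sym (lincomb-· A c (column M j)))

  lincomb-⟂ : (A : Matrix k m) {y : Vec m} → A *ᵥ y ≈ᵥ 0ᵥ → ∀ c → lincomb A c ⟂ y
  lincomb-⟂ A {y} Ay≈0 c = trans (lincomb-· A c y) (·-zeroʳ c Ay≈0)

  lincomb-shear : (A : Matrix (suc k) m) (μ c : Vec k) →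
                  lincomb (λ t → A (suc t) +ᵥ (μ t ·ᵥ A zero)) c ≈ᵥ lincomb A (c · μ ∷ c)
  lincomb-shear A μ c j = begin
    c · (λ t → A (suc t) j + μ t * A zero j)             ≈⟨ ·-distribˡ-+ᵥ c _ _ ⟩
    c · column (A ∘ suc) j + c · (λ t → μ t * A zero j)  ≈⟨ +-congˡ (·-*ʳ c μ (A zero j)) ⟩
    c · column (A ∘ suc) j + (c · μ) * A zero j          ≈⟨ +-comm _ _ ⟩
    lincomb A (c · μ ∷ c) j                              ∎

  row∈RowSpace : (M : Matrix m n) (t : Fin m) → M t ∈ RowSpace M
  row∈RowSpace M t = basis t , λ j → sym (lincomb-basis M t j)

  RowSpace-resp : (M : Matrix m n) {u v : Vec n} → u ≈ᵥ v → u ∈ RowSpace M → v ∈ RowSpace M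
  RowSpace-resp M u≈v (a , u≈Ma) = a , λ j → trans (sym (u≈v j)) (u≈Ma j)

  RowSpace-+ᵥ : (M : Matrix m n) {u v : Vec n} →
                u ∈ RowSpace M → v ∈ RowSpace M → u +ᵥ v ∈ RowSpace M
  RowSpace-+ᵥ M (a , u≈Ma) (b , v≈Mb) =
    a +ᵥ b , λ j → trans (+-cong (u≈Ma j) (v≈Mb j)) (sym (·-distribʳ-+ᵥ a b (column M j)))

  RowSpace-·ᵥ : (M : Matrix m n) (x : Carrier) {u : Vec n} → u ∈ RowSpace M → x ·ᵥ u ∈ RowSpace M
  RowSpace-·ᵥ M x (a , u≈Ma) = x ·ᵥ a , λ j → trans (*-congˡ (u≈Ma j)) (sym (·ᵥ-· x a (column M j)))

  Cw⊆RowSpace : (M : Matrix m n) (y : Vec m) → Cw M y ⊆ RowSpace M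
  Cw⊆RowSpace M y (a , _ , x≈Ma) = a , x≈Ma

  SameSet-trans : {C D E : Pred (Vec n) 0ℓ} → SameSet C D → SameSet D E → SameSet C E
  SameSet-trans C≐D D≐E x = proj₁ (D≐E x) ∘ proj₁ (C≐D x) , proj₂ (C≐D x) ∘ proj₂ (D≐E x)

  SameSet-sym : {C D : Pred (Vec n) 0ℓ} → SameSet C D → SameSet D C
  SameSet-sym C≐D x = swap (C≐D x)

  row≉0 : (A : Matrix k m) → RowsIndependent A → ∀ t → ¬ (A t ≈ᵥ 0ᵥ)
  row≉0 A indA t Aₜ≈0 =
    1≉0 (trans (reflexive (≡.sym (basis-diag t)))
               (indA (basis t) (λ j → trans (lincomb-basis A t j) (Aₜ≈0 j)) t))

  rowsIndependent-factor : (A : Matrix k r) (M : Matrix r n) {G : Matrix k n} → G ≈ₘ A *ₘ M →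
                           RowsIndependent G → RowsIndependent A
  rowsIndependent-factor A M {G} G≈AM indG c Ac≈0 = indG c λ j → begin
    lincomb G c j                ≈⟨ lincomb-factor A M G≈AM c j ⟩
    lincomb M (lincomb A c) j    ≈⟨ lincomb-congʳ M Ac≈0 j ⟩
    0ᵥ · column M j              ≈⟨ ·-zeroˡ (column M j) (λ _ → refl) ⟩
    0#                           ∎

  rowsIndependent-*ₘ : (A : Matrix k r) (M : Matrix r n) → RowsIndependent M → RowsIndependent A →
                       RowsIndependent (A *ₘ M)
  rowsIndependent-*ₘ A M indM indA c AMc≈0 =
    indA c (indM (lincomb A c) (λ j → trans (sym (lincomb-factor A M (λ _ _ → refl) c j)) (AMc≈0 j)))

  rowSpace-factor : (A : Matrix k r) (M : Matrix r n) {G : Matrix k n} {y : Vec r} →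
                    G ≈ₘ A *ₘ M → RowSpace≐⟂ A y → SameSet (RowSpace G) (Cw M y)
  rowSpace-factor A M {G} {y} G≈AM (Ay≈0 , y⟂⊆RA) x = to , from
    where
    to : x ∈ RowSpace G → x ∈ Cw M y
    to (c , x≈Gc) = lincomb A c , lincomb-⟂ A Ay≈0 c , λ j → trans (x≈Gc j) (lincomb-factor A M G≈AM c j)
    from : x ∈ Cw M y → x ∈ RowSpace G
    from (a , a⟂y , x≈Ma) =
      let c , a≈Ac = y⟂⊆RA a a⟂y
      in c , λ j → trans (x≈Ma j) (trans (lincomb-congʳ M a≈Ac j) (sym (lincomb-factor A M G≈AM c j)))

  -- Projectivity of the columns of A M

  proportional-images⇒kernel : (A : Matrix k m) {u w : Vec m} {c : Carrier} →
    A *ᵥ u ≈ᵥ (c ·ᵥ (A *ᵥ w)) → A *ᵥ (u +ᵥ ((- c) ·ᵥ w)) ≈ᵥ 0ᵥ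
  proportional-images⇒kernel A {u} {w} {c} Au≈cAw t = begin
    A t · (u +ᵥ ((- c) ·ᵥ w))        ≈⟨ ·-distribˡ-+ᵥ (A t) _ _ ⟩
    A t · u + A t · ((- c) ·ᵥ w)     ≈⟨ +-cong (Au≈cAw t) (·-·ᵥ (- c) (A t) w) ⟩
    c * (A t · w) + - c * (A t · w)  ≈⟨ +-congˡ (-‿distribˡ-* c _) ⟨
    c * (A t · w) - c * (A t · w)    ≈⟨ -‿inverseʳ _ ⟩
    0#                               ∎

  projective-*ₘ⇒InY : (A : Matrix k r) (M : Matrix r n) {G : Matrix k n} {y : Vec r} →
    G ≈ₘ A *ₘ M → ProjectiveColumns G → ¬ (y ≈ᵥ 0ᵥ) → A *ᵥ y ≈ᵥ 0ᵥ → InY M y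
  projective-*ₘ⇒InY A M {G} {y} G≈AM (G≉0 , G-nonprop) y≉0 Ay≈0 = (y≉0 , y≁l) , y≠αl+βl
    where
    l = column M
    y≁l : ∀ j → ¬ Proportional y (l j)
    y≁l j (c , y≈clⱼ) = G≉0 j λ t → trans (G≈AM t j) (xy≈0⇒y≈0 c≉0 (begin
      c * (A t · l j)   ≈⟨ ·-·ᵥ c (A t) (l j) ⟨
      A t · (c ·ᵥ l j)  ≈⟨ ·-cong (λ _ → refl) y≈clⱼ ⟨
      A t · y           ≈⟨ Ay≈0 t ⟩
      0#                ∎))
      where
      c≉0 : c ≉ 0#
      c≉0 c≈0 = y≉0 λ i → trans (y≈clⱼ i) (trans (*-congʳ c≈0) (zeroˡ _))
    y≠αl+βl : ∀ α β i j → α ≉ 0# → β ≉ 0# → ¬ (y ≈ᵥ ((α ·ᵥ l i) +ᵥ (β ·ᵥ l j)))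
    y≠αl+βl α β i j α≉0 _ y≈αlᵢ+βlⱼ with i Fin.≟ j
    ... | yes ≡.refl = y≁l i (α + β , λ t → trans (y≈αlᵢ+βlⱼ t) (sym (distribʳ _ α β)))
    ... | no i≢j     = G-nonprop i j i≢j (- (inv α α≉0 * β) , λ t →
          trans (G≈AM t i) (trans (solve-linear α≉0 (αAlᵢ+βAlⱼ≈0 t)) (*-congˡ (sym (G≈AM t j)))))
      where
      αAlᵢ+βAlⱼ≈0 : ∀ t → α * (A t · l i) + β * (A t · l j) ≈ 0#
      αAlᵢ+βAlⱼ≈0 t = begin
        α * (A t · l i) + β * (A t · l j)    ≈⟨ +-cong (·-·ᵥ α (A t) (l i)) (·-·ᵥ β (A t) (l j)) ⟨
        A t · (α ·ᵥ l i) + A t · (β ·ᵥ l j)  ≈⟨ ·-distribˡ-+ᵥ (A t) _ _ ⟨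
        A t · ((α ·ᵥ l i) +ᵥ (β ·ᵥ l j))     ≈⟨ ·-cong (λ _ → refl) y≈αlᵢ+βlⱼ ⟨
        A t · y                              ≈⟨ Ay≈0 t ⟩
        0#                                   ∎

  -- Normal vectors of hyperplanes

  -- One step of Gaussian elimination, pivoting on the entry p of row zero.
  module Elimination (A : Matrix (suc k) (suc m)) (p : Fin (suc m)) (A₀ₚ≉0 : A zero p ≉ 0#) where
    π : Carrier
    π = inv (A zero p) A₀ₚ≉0

    clear : Vec (suc m) → Vec (suc m)
    clear v = v +ᵥ ((- (π * v p)) ·ᵥ A zero)

    clear-pivot : (v : Vec (suc m)) → clear v p ≈ 0#
    clear-pivot v = begin
      v p + - (π * v p) * A zero p  ≈⟨ +-congˡ (-‿distribˡ-* _ _) ⟨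
      v p - π * v p * A zero p      ≈⟨ +-congˡ (-‿cong (inv-cancelʳ _ A₀ₚ≉0 (v p))) ⟩
      v p - v p                     ≈⟨ -‿inverseʳ (v p) ⟩
      0#                            ∎

    clear-decompose : (v : Vec (suc m)) → v ≈ᵥ (clear v +ᵥ ((π * v p) ·ᵥ A zero))
    clear-decompose v j = begin
      v j                                            ≈⟨ //-rightDividesˡ _ (v j) ⟨
      v j - π * v p * A zero j + π * v p * A zero j  ≈⟨ +-congʳ (+-congˡ (-‿distribˡ-* _ _)) ⟩
      clear v j + π * v p * A zero j                 ∎

    μ : Vec k
    μ t = - (π * A (suc t) p)

    cleared : Matrix k (suc m)
    cleared t = clear (A (suc t))

    reduced : Matrix k m
    reduced t = removeAt (cleared t) p

    lincomb-cleared-pivot : (c : Vec k) → lincomb cleared c p ≈ 0#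
    lincomb-cleared-pivot c = ·-zeroʳ c (λ t → clear-pivot (A (suc t)))

    reduced-independent : RowsIndependent A → RowsIndependent reduced
    reduced-independent indA c reduced·c≈0 t = indA (c · μ ∷ c) A·c≈0 (suc t)
      where
      A·c≈0 : lincomb A (c · μ ∷ c) ≈ᵥ 0ᵥ
      A·c≈0 j = trans (sym (lincomb-shear A μ c j))
                      (≈ᵥ-split p (lincomb-cleared-pivot c) reduced·c≈0 j)

    -- The entry at p is chosen to make row zero orthogonal to the lift.
    lift : Vec m → Vec (suc m)
    lift y⁻ = insertAt y⁻ p (- (π * (removeAt (A zero) p · y⁻)))

    A₀⟂lift : (y⁻ : Vec m) → A zero ⟂ lift y⁻
    A₀⟂lift y⁻ = begin
      A zero · lift y⁻            ≈⟨ ·-insertAt (A zero) y⁻ p _ ⟩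
      A zero p * - (π * S) + S    ≈⟨ +-congʳ (-‿distribʳ-* _ _) ⟨
      - (A zero p * (π * S)) + S  ≈⟨ +-congʳ (-‿cong (trans (*-comm _ _) (inv-cancelʳ _ A₀ₚ≉0 S))) ⟩
      - S + S                     ≈⟨ -‿inverseˡ S ⟩
      0#                          ∎
      where S = removeAt (A zero) p · y⁻

    clear-· : (v : Vec (suc m)) (y⁻ : Vec m) → clear v · lift y⁻ ≈ v · lift y⁻
    clear-· v y⁻ = begin
      clear v · lift y⁻                               ≈⟨ ·-distribʳ-+ᵥ v (ν ·ᵥ A zero) (lift y⁻) ⟩
      v · lift y⁻ + (ν ·ᵥ A zero) · lift y⁻           ≈⟨ +-congˡ (·ᵥ-· ν (A zero) (lift y⁻)) ⟩
      v · lift y⁻ + ν * (A zero · lift y⁻)            ≈⟨ +-congˡ (trans (*-congˡ (A₀⟂lift y⁻)) (zeroʳ ν)) ⟩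
      v · lift y⁻ + 0#                                ≈⟨ +-identityʳ _ ⟩
      v · lift y⁻                                     ∎
      where ν = - (π * v p)

    lift-RowSpace≐⟂ : {y⁻ : Vec m} → RowSpace≐⟂ reduced y⁻ → RowSpace≐⟂ A (lift y⁻)
    lift-RowSpace≐⟂ {y⁻} (reduced⟂y⁻ , y⁻⟂⊆R) = A⟂y , y⟂⊆RA
      where
      y = lift y⁻
      A⟂y : A *ᵥ y ≈ᵥ 0ᵥ
      A⟂y zero    = A₀⟂lift y⁻
      A⟂y (suc t) = begin
        A (suc t) · y   ≈⟨ clear-· (A (suc t)) y⁻ ⟨
        cleared t · y   ≈⟨ ·-insertAt-vanishing (cleared t) y⁻ p _ (clear-pivot (A (suc t))) ⟩
        reduced t · y⁻  ≈⟨ reduced⟂y⁻ t ⟩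
        0#              ∎
      y⟂⊆RA : ∀ a → a ⟂ y → a ∈ RowSpace A
      y⟂⊆RA a a⟂y =
        let c , a′⁻≈reduced·c = y⁻⟂⊆R (removeAt (clear a) p) a′⁻⟂y⁻
            a′≈cleared·c = ≈ᵥ-split p (trans (clear-pivot a) (sym (lincomb-cleared-pivot c))) a′⁻≈reduced·c
        in RowSpace-resp A (λ j → sym (clear-decompose a j))
             (RowSpace-+ᵥ A (c · μ ∷ c , λ j → trans (a′≈cleared·c j) (lincomb-shear A μ c j))
                            (RowSpace-·ᵥ A _ (row∈RowSpace A zero)))
        where
        a′⁻⟂y⁻ : removeAt (clear a) p ⟂ y⁻
        a′⁻⟂y⁻ = trans (sym (·-insertAt-vanishing (clear a) y⁻ p _ (clear-pivot a))) (trans (clear-· a y⁻) a⟂y)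

  module HyperplaneBasis (y : Vec (suc k)) (p : Fin (suc k)) (yₚ≉0 : y p ≉ 0#) where
    π : Carrier
    π = inv (y p) yₚ≉0

    B : Matrix k (suc k)
    B t = insertAt (basis t) p (- (π * y (punchIn p t)))

    B-· : ∀ t v → B t · v ≈ - (π * y (punchIn p t)) * v p + v (punchIn p t)
    B-· t v = trans (insertAt-· (basis t) p _ v) (+-congˡ (basis-· t (removeAt v p)))

    B⟂y : B *ᵥ y ≈ᵥ 0ᵥ
    B⟂y t = begin
      B t · y                ≈⟨ B-· t y ⟩
      - (π * yₜ) * y p + yₜ  ≈⟨ +-congʳ (-‿distribˡ-* _ _) ⟨
      - (π * yₜ * y p) + yₜ  ≈⟨ +-congʳ (-‿cong (inv-cancelʳ _ yₚ≉0 yₜ)) ⟩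
      - yₜ + yₜ              ≈⟨ -‿inverseˡ yₜ ⟩
      0#                     ∎
      where yₜ = y (punchIn p t)

    B-kernel : ∀ v → B *ᵥ v ≈ᵥ 0ᵥ → Proportional v y
    B-kernel v Bv≈0 = π * v p , ≈ᵥ-split p (sym (inv-cancelʳ _ yₚ≉0 (v p))) vₜ≈
      where
      vₜ≈ : ∀ t → v (punchIn p t) ≈ π * v p * y (punchIn p t)
      vₜ≈ t = begin
        v (punchIn p t)                    ≈⟨ +-inverseʳ-unique _ _ (trans (sym (B-· t v)) (Bv≈0 t)) ⟩
        - (- (π * y (punchIn p t)) * v p)  ≈⟨ -[-x*y]≈x*y _ _ ⟩
        π * y (punchIn p t) * v p          ≈⟨ xy∙z≈xz∙y π _ _ ⟩
        π * v p * y (punchIn p t)          ∎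

    lincomb-B-punchIn : ∀ c s → lincomb B c (punchIn p s) ≈ c s
    lincomb-B-punchIn c s = trans (·-cong (λ _ → refl) Bₜₛ≈) (·-basis c s)
      where
      Bₜₛ≈ : ∀ t → B t (punchIn p s) ≈ basis s t
      Bₜₛ≈ t = reflexive (≡.trans (insertAt-punchIn (basis t) p _ s) (basis-comm t s))

    B-independent : RowsIndependent B
    B-independent c Bc≈0 s = trans (sym (lincomb-B-punchIn c s)) (Bc≈0 (punchIn p s))

    y⟂⊆RB : ∀ a → a ⟂ y → a ∈ RowSpace B
    y⟂⊆RB a a⟂y = a⁻ , ⟂-unique {w = lincomb B a⁻} {y} p yₚ≉0 a⟂y (lincomb-⟂ B {y} B⟂y a⁻)
                                (λ s → sym (lincomb-B-punchIn a⁻ s))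
      where a⁻ = removeAt a p

  module _ (_≟_ : Decidable _≈_) where

    pivot : {v : Vec m} → ¬ (v ≈ᵥ 0ᵥ) → ∃[ p ] (v p ≉ 0#)
    pivot {m} {v} v≉0 = ¬∀⟶∃¬ m (λ i → v i ≈ 0#) (λ i → v i ≟ 0#) v≉0

    InY⇒projective-*ₘ : (A : Matrix k r) (M : Matrix r n) {y : Vec r} →
      ProjectiveColumns M → InY M y → (∀ v → A *ᵥ v ≈ᵥ 0ᵥ → Proportional v y) →
      ProjectiveColumns (A *ₘ M)
    InY⇒projective-*ₘ A M {y} (l≉0 , l-nonprop) ((_ , y≁l) , y≠αl+βl) ker = Al≉0 , Al-nonprop
      where
      l = column M
      Al≉0 : ∀ j → ¬ (A *ᵥ l j ≈ᵥ 0ᵥ)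
      Al≉0 j Alⱼ≈0 with ker (l j) Alⱼ≈0
      ... | c , lⱼ≈cy with c ≟ 0#
      ...   | yes c≈0 = l≉0 j λ i → trans (lⱼ≈cy i) (trans (*-congʳ c≈0) (zeroˡ _))
      ...   | no c≉0  = y≁l j (inv c c≉0 , λ i → *-solveˡ c≉0 (lⱼ≈cy i))
      Al-nonprop : ∀ i j → i ≢ j → ¬ Proportional (A *ᵥ l i) (A *ᵥ l j)
      Al-nonprop i j i≢j (c , Alᵢ≈cAlⱼ) with c ≟ 0#
      ... | yes c≈0 = Al≉0 i λ t → trans (Alᵢ≈cAlⱼ t) (trans (*-congʳ c≈0) (zeroˡ _))
      ... | no c≉0 with ker (l i +ᵥ ((- c) ·ᵥ l j)) (proportional-images⇒kernel A Alᵢ≈cAlⱼ)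
      ...   | δ , v≈δy with δ ≟ 0#
      ...     | yes δ≈0 = l-nonprop i j i≢j (c , λ t →
                trans (+-inverseˡ-unique _ _ (trans (v≈δy t) (trans (*-congʳ δ≈0) (zeroˡ _))))
                      (-[-x*y]≈x*y c _))
      ...     | no δ≉0  = y≠αl+βl δ⁻¹ (δ⁻¹ * - c) i j (inv≉0 δ δ≉0) (*-≉0 (inv≉0 δ δ≉0) (-‿≉0 c≉0)) λ t →
                trans (*-solveˡ δ≉0 (v≈δy t)) (trans (distribˡ _ _ _) (+-congˡ (sym (*-assoc _ _ _))))
        where δ⁻¹ = inv δ δ≉0

    normalVector : ∀ k (A : Matrix k (suc k)) → RowsIndependent A →
                   ∃[ y ] (¬ (y ≈ᵥ 0ᵥ) × RowSpace≐⟂ A y)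
    normalVector zero A _ = (λ _ → 1#) , (λ 1≈0 → 1≉0 (1≈0 zero)) , (λ ()) , λ a a⟂1 →
      (λ ()) , λ { zero → trans (sym (trans (+-identityʳ _) (*-identityʳ (a zero)))) a⟂1 }
    normalVector (suc k) A indA with pivot (row≉0 A indA zero)
    ... | p , A₀ₚ≉0 =
      let open Elimination A p A₀ₚ≉0
          y⁻ , y⁻≉0 , R≐y⁻⟂ = normalVector k reduced (reduced-independent indA)
      in lift y⁻ , insertAt-≉0 p _ y⁻≉0 , lift-RowSpace≐⟂ R≐y⁻⟂

    hyperplaneBasis : {y : Vec (suc k)} → ¬ (y ≈ᵥ 0ᵥ) →
      ∃[ B ] (RowsIndependent B × RowSpace≐⟂ B y × (∀ v → B *ᵥ v ≈ᵥ 0ᵥ → Proportional v y))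
    hyperplaneBasis {y = y} y≉0 with pivot y≉0
    ... | p , yₚ≉0 = B , B-independent , (B⟂y , y⟂⊆RB) , B-kernel
      where open HyperplaneBasis y p yₚ≉0

    projectiveSubcode⇒Cw : (M : Matrix (suc k) n) (C : Pred (Vec n) 0ℓ) →
      IsProjectiveCode n k C × C ⊆ RowSpace M → ∃[ y ] (InY M y × SameSet C (Cw M y))
    projectiveSubcode⇒Cw {k} M C ((G , (indG , C≐RG) , projG) , C⊆RM) =
      let y , y≉0 , RA≐y⟂ = normalVector k A (rowsIndependent-factor A M G≈AM indG)
      in y , projective-*ₘ⇒InY A M G≈AM projG y≉0 (proj₁ RA≐y⟂)
           , SameSet-trans C≐RG (rowSpace-factor A M {y = y} G≈AM RA≐y⟂)
      where
      Gₜ∈RM : ∀ t → G t ∈ RowSpace M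
      Gₜ∈RM t = C⊆RM (proj₂ (C≐RG (G t)) (row∈RowSpace G t))
      A : Matrix k (suc k)
      A t = proj₁ (Gₜ∈RM t)
      G≈AM : G ≈ₘ A *ₘ M
      G≈AM t = proj₂ (Gₜ∈RM t)

    Cw⇒projectiveSubcode : (M : Matrix (suc k) n) → RowsIndependent M → ProjectiveColumns M →
      ∀ C y → InY M y → SameSet C (Cw M y) → IsProjectiveCode n k C × C ⊆ RowSpace M
    Cw⇒projectiveSubcode M indM projM C y y∈Y@((y≉0 , _) , _) C≐Cy =
      let B , indB , RB≐y⟂ , kerB = hyperplaneBasis y≉0
          C≐RBM = SameSet-trans C≐Cy (SameSet-sym (rowSpace-factor B M {y = y} (λ _ _ → refl) RB≐y⟂))
      in (B *ₘ M , (rowsIndependent-*ₘ B M indM indB , C≐RBM) , InY⇒projective-*ₘ B M projM y∈Y kerB)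
         , λ x∈C → Cw⊆RowSpace M y (proj₁ (C≐Cy _) x∈C)

lemma1 : (q : ℕ) (Fq : FiniteField q) (n k : ℕ) → 1 < k → k < n ∸ 1 →
    let open Codes (FiniteField.field′ Fq) in
    (M : Matrix (suc k) n) →
    RowsIndependent M → ProjectiveColumns M →
    ∀ C → ((IsProjectiveCode n k C × C ⊆ RowSpace M) → ∃[ y ] (InY M y × SameSet C (Cw M y)))
        × (∀ y → InY M y → SameSet C (Cw M y) → IsProjectiveCode n k C × C ⊆ RowSpace M)
lemma1 q Fq n k _ _ M indM projM C =
  projectiveSubcode⇒Cw F (≈-dec Fq) M C , Cw⇒projectiveSubcode F (≈-dec Fq) M indM projM C
  where F = FiniteField.field′ Fq
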